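{- Let $\mathscr D$ be a class of finite graphs and $f$ a function such that for every $\epsilon>0$ every graph in $\mathscr D$ has an $\epsilon$-nice partition with $f(\epsilon)$ parts. Let $\mathscr C$ be a class $2$-covered by $\mathscr D$ with magnitude $p$. Then for every $\epsilon>0$ every graph $G\in\mathscr C$ has an $\epsilon$-nice partition with $K\leq p\,f\bigl(\frac{\epsilon}{p-1}\bigr)^{p-1}$ parts.
   Context: A class $\mathscr C$ is $2$-covered by $\mathscr D$ if there is $K\geq 2$ such that every $G\in\mathscr C$ has a vertex partition $V_1,\dots,V_K$ with $G[V_i\cup V_j]\in\mathscr D$ for all $1\leq i<j\leq K$; the minimum such $K$ is the magnitude. For an $n$-vertex graph $G$, a partition $V_1,\dots,V_k$ of $V(G)$ is $\epsilon$-nice if $\sum\frac{|V_i||V_j|}{n^2}<\epsilon$, the sum over pairs $(i,j)\in[k]^2$ with $(V_i,V_j)$ not homogeneous, where $(A,B)$ is homogeneous if either all pairs $\{a,b\}$, $a\in A$, $b\in B$, $a\neq b$, are edges or none are.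
   Formalization: The parameter ε ranges over the positive rationals, and the function f is defined on ℚ. -}

module Defs where

open import Data.Bool using (Bool; true; false; T; if_then_else_; _∨_)
open import Data.Nat using (ℕ; zero; suc; _*_; _≤_; _<_; _∸_)
open import Data.Fin using (Fin) renaming (_<_ to _<ᶠ_)
import Data.Fin as Fin
open import Data.Fin.Properties using (all?)
open import Data.List using (List; length; filter; lookup; map; allFin)
open import Data.Nat.ListAction using (sum)
open import Data.Product using (Σ; ∃; _×_)
open import Data.Unit using (⊤)
open import Data.Empty using (⊥)
open import Data.Integer using (+_)
open import Data.Rational using (ℚ; 0ℚ; _/_) renaming (_*_ to _*ℚ_; _<_ to _<ℚ_)
open import Relation.Nullary using (¬_; Dec; yes; no; does)
open import Relation.Nullary.Decidable using (⌊_⌋; _⊎-dec_; _×-dec_; _→-dec_)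
open import Relation.Binary.PropositionalEquality using (_≡_)
open import Data.Bool.Properties using (T?)
open import Data.Sum using (_⊎_)

record Graph : Set where
  field
    n     : ℕ
    adj   : Fin n → Fin n → Bool
    sym   : ∀ u v → adj u v ≡ adj v u
    irrefl : ∀ v → adj v v ≡ false
open Graph public

Class : Set₁
Class = Graph → Set

-- A partition of V(G) into k (possibly empty) labelled parts V_0,...,V_{k-1}.
Partition : Graph → ℕ → Set
Partition G k = Fin (n G) → Fin k

induced : (G : Graph) → (Fin (n G) → Bool) → Graph
induced G S = record
  { n = length vs
  ; adj = λ a b → adj G (lookup vs a) (lookup vs b)
  ; sym = λ a b → sym G (lookup vs a) (lookup vs b)
  ; irrefl = λ a → irrefl G (lookup vs a)
  }
  where
  vs : List (Fin (n G))
  vs = filter (λ v → T? (S v)) (allFin (n G))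

unionPart : ∀ {G k} → Partition G k → Fin k → Fin k → Fin (n G) → Bool
unionPart P i j v = ⌊ P v Fin.≟ i ⌋ ∨ ⌊ P v Fin.≟ j ⌋

CoveredWith : Class → Class → ℕ → Set
CoveredWith C D K =
  ∀ (G : Graph) → C G →
    Σ (Partition G K) λ P → ∀ (i j : Fin K) → i <ᶠ j → D (induced G (unionPart {G} P i j))

TwoCoveredMagnitude : Class → Class → ℕ → Set
TwoCoveredMagnitude C D p =
  (2 ≤ p) × CoveredWith C D p × (∀ K → 2 ≤ K → K < p → ¬ CoveredWith C D K)

Homogeneous : (G : Graph) {k : ℕ} → Partition G k → Fin k → Fin k → Set
Homogeneous G P i j =
  (∀ a b → P a ≡ i → P b ≡ j → ¬ (a ≡ b) → adj G a b ≡ true)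
  ⊎ (∀ a b → P a ≡ i → P b ≡ j → ¬ (a ≡ b) → adj G a b ≡ false)

homogeneous? : (G : Graph) {k : ℕ} (P : Partition G k) (i j : Fin k) → Dec (Homogeneous G P i j)
homogeneous? G P i j =
  all? (λ a → all? (λ b → (P a Fin.≟ i) →-dec ((P b Fin.≟ j) →-dec ((¬? (a Fin.≟ b)) →-dec (adj G a b Data.Bool.≟ true)))))
  ⊎-dec
  all? (λ a → all? (λ b → (P a Fin.≟ i) →-dec ((P b Fin.≟ j) →-dec ((¬? (a Fin.≟ b)) →-dec (adj G a b Data.Bool.≟ false)))))
  where
  import Data.Bool
  open import Relation.Nullary.Decidable using (¬?)

partSize : (G : Graph) {k : ℕ} → Partition G k → Fin k → ℕ
partSize G P i = length (filter (λ v → P v Fin.≟ i) (allFin (n G)))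

badMass : (G : Graph) {k : ℕ} → Partition G k → ℕ
badMass G {k} P =
  sum (map (λ i → sum (map (λ j →
        if does (homogeneous? G P i j) then 0 else partSize G P i * partSize G P j)
      (allFin k))) (allFin k))

-- the quantity Σ |V_i||V_j| / n^2 (for n = 0 the sum is empty, hence 0)
niceSum : (G : Graph) {k : ℕ} → Partition G k → ℚ
niceSum G P = ratio (badMass G P) (n G)
  where
  ratio : ℕ → ℕ → ℚ
  ratio s zero = 0ℚ
  ratio s (suc m) = (+ s) / (suc m * suc m)

Nice : (G : Graph) {k : ℕ} → ℚ → Partition G k → Set
Nice G ε P = niceSum G P <ℚ ε

-- ε / m  (used only with m ≥ 1; value at m = 0 is irrelevant junk)
divBy : ℚ → ℕ → ℚ
divBy ε zero = 0ℚ
divBy ε (suc m) = ε *ℚ ((+ 1) / suc m)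

module Submission where

-- Let G ∈ C, let Q : V(G) → Fin p be a partition witnessing the covering
-- (p ≥ 2, every G[V_i ∪ V_j] with i < j lies in D), put ε′ = ε/(p-1) and let
-- R_ij be an ε′-nice partition of G[V_i ∪ V_j] into f ε′ parts.  The common
-- refinement labels a vertex u by its part Q u and its R-classes in the p-1
-- graphs G[V_{Q u} ∪ V_b], b ≠ Q u, so it has p·(f ε′)^(p-1) parts.
--
-- The bad mass of a partition is a sum over ordered pairs of vertices
-- (badMass-pairs).  Every pair of vertices lies in some V_i ∪ V_j, i < j
-- (cover), and since the refinement refines R_ij there, a pair that is bad
-- for the refinement is bad for R_ij (Induced.Refining).  Hence
--   bad(refinement) ≤ Σ_{i<j} bad(R_ij) < ε′ Σ_{i<j} |V_i ∪ V_j|² ≤ ε′ (p-1) n²,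
-- the last step because each vertex lies in exactly p-1 of the sets
-- V_i ∪ V_j (pairs-containing).  After clearing the denominator of ε all of
-- this is an inequality between natural numbers.

open import Data.Bool using (Bool; true; false; if_then_else_; T; _∨_)
open import Data.Bool.Properties using (T-∨)
open import Data.Empty using (⊥-elim)
import Data.Empty.Irrelevant as Irrelevant
open import Data.Fin as Fin using (Fin; zero; suc)
import Data.Fin.Properties as Fin
import Data.Integer as ℤ
import Data.Integer.Properties as ℤP
open import Data.List using (List; []; _∷_; length; filter; map; allFin; tabulate; lookup)
open import Data.List.Membership.Propositional using (_∈_)
open import Data.List.Membership.Propositional.Properties using (∈-filter⁺; ∈-filter⁻; ∈-allFin; ∈-lookup)
import Data.List.Relation.Unary.All as All
import Data.List.Relation.Unary.Any as Any
open import Data.List.Relation.Unary.Any.Properties using (lookup-index)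
open import Data.List.Relation.Unary.AllPairs using (_∷_)
open import Data.List.Relation.Unary.Unique.Propositional using (Unique)
open import Data.List.Relation.Unary.Unique.Propositional.Properties using (filter⁺; allFin⁺)
open import Data.Nat using (ℕ; zero; suc; _+_; _*_; _^_; _∸_; _≤_; _<_; z≤n; s≤s; >-nonZero⁻¹)
import Data.Nat.ListAction as List
open import Data.Nat.Properties
open import Algebra.Properties.CommutativeSemigroup *-commutativeSemigroup using (x∙yz≈y∙xz)
open import Algebra.Properties.Semiring.Sum +-*-semiring
  using (sum; sum-syntax; sum-cong-≗; ∑-comm; ∑-distrib-+; *-distribˡ-sum; *-distribʳ-sum)
open import Data.Product using (Σ; _,_; proj₁; proj₂; _×_)
open import Data.Rational as ℚ using (ℚ; mkℚ; 0ℚ)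
import Data.Rational.Properties as ℚP
open import Data.Rational.Unnormalised as ℚᵘ using (mkℚᵘ; *<*)
import Data.Rational.Unnormalised.Properties as ℚᵘP
open import Data.Sum as Sum using (_⊎_; inj₁; inj₂)
open import Defs hiding (sym)
open import Function using (_∘_)
open import Function.Bundles using (Equivalence)
open import Relation.Binary.Definitions using (tri<; tri≈; tri>)
open import Relation.Binary.PropositionalEquality
open import Relation.Nullary using (Dec; yes; no; does; ¬_)
open import Relation.Nullary.Decidable
  using (¬?; T?; isYes; recompute; dec-true; dec-false; fromWitness; toWitness)
open import Relation.Unary using (Pred; Decidable)

𝟙ᵇ : Bool → ℕ
𝟙ᵇ b = if b then 1 else 0

𝟙 : ∀ {A : Set} → Dec A → ℕ
𝟙 d = 𝟙ᵇ (does d)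

𝟙-yes : ∀ {A : Set} (d : Dec A) → A → 𝟙 d ≡ 1
𝟙-yes d a = cong 𝟙ᵇ (dec-true d a)

𝟙-no : ∀ {A : Set} (d : Dec A) → ¬ A → 𝟙 d ≡ 0
𝟙-no d ¬a = cong 𝟙ᵇ (dec-false d ¬a)

𝟙ᵇ-T : ∀ {b} → T b → 𝟙ᵇ b ≡ 1
𝟙ᵇ-T {true} _ = refl

𝟙ᵇ-isYes : ∀ {A : Set} (d : Dec A) → 𝟙ᵇ (isYes d) ≡ 𝟙 d
𝟙ᵇ-isYes (yes _) = refl
𝟙ᵇ-isYes (no _) = refl

𝟙ᵇ-∨ : ∀ x y → 𝟙ᵇ (x ∨ y) ≤ 𝟙ᵇ x + 𝟙ᵇ y
𝟙ᵇ-∨ true y = s≤s z≤n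
𝟙ᵇ-∨ false y = ≤-refl

𝟙ᵇ-∧≤ : ∀ a b → 𝟙ᵇ a * (𝟙ᵇ b * 1) ≤ 𝟙ᵇ a
𝟙ᵇ-∧≤ true true = ≤-refl
𝟙ᵇ-∧≤ true false = z≤n
𝟙ᵇ-∧≤ false b = z≤n

𝟙¬-mono : ∀ {A B : Set} (a? : Dec A) (b? : Dec B) → (B → A) → 𝟙 (¬? a?) ≤ 𝟙 (¬? b?)
𝟙¬-mono (yes _) b? b→a = z≤n
𝟙¬-mono (no _) (no _) b→a = s≤s z≤n
𝟙¬-mono (no ¬a) (yes b) b→a = ⊥-elim (¬a (b→a b))

∑-mono-≤ : ∀ {k} {f g : Fin k → ℕ} → (∀ i → f i ≤ g i) → sum f ≤ sum g
∑-mono-≤ {zero} f≤g = z≤n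
∑-mono-≤ {suc k} f≤g = +-mono-≤ (f≤g zero) (∑-mono-≤ (f≤g ∘ suc))

∑-mono-< : ∀ {k} {f g : Fin k → ℕ} → (∀ i → f i ≤ g i) → (a : Fin k) → f a < g a → sum f < sum g
∑-mono-< {suc k} f≤g zero fa<ga = +-mono-<-≤ fa<ga (∑-mono-≤ (f≤g ∘ suc))
∑-mono-< {suc k} f≤g (suc a) fa<ga = +-mono-≤-< (f≤g zero) (∑-mono-< (f≤g ∘ suc) a fa<ga)

term≤∑ : ∀ {k} (f : Fin k → ℕ) (a : Fin k) → f a ≤ sum f
term≤∑ f zero = m≤m+n _ _
term≤∑ f (suc a) = ≤-trans (term≤∑ (f ∘ suc) a) (m≤n+m _ _)

∑-const : ∀ k c → ∑[ i < k ] c ≡ k * c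
∑-const zero c = refl
∑-const (suc k) c = cong (c +_) (∑-const k c)

∑-delta : ∀ {k} (c : Fin k → ℕ) (a : Fin k) → ∑[ j < k ] (c j * 𝟙 (a Fin.≟ j)) ≡ c a
∑-delta {suc k} c zero = begin
  c zero * 1 + ∑[ j < k ] (c (suc j) * 0) ≡⟨ cong₂ _+_ (*-identityʳ (c zero)) (sum-cong-≗ (*-zeroʳ ∘ c ∘ suc)) ⟩
  c zero + ∑[ j < k ] 0                   ≡⟨ cong (c zero +_) (trans (∑-const k 0) (*-zeroʳ k)) ⟩
  c zero + 0                              ≡⟨ +-identityʳ (c zero) ⟩
  c zero                                  ∎
  where open ≡-Reasoning
∑-delta {suc k} c (suc a) = cong₂ _+_ (*-zeroʳ (c zero)) (∑-delta (c ∘ suc) a)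

∑-fibres : ∀ {m k} (P : Fin m → Fin k) (c : Fin k → ℕ) →
  ∑[ j < k ] (c j * ∑[ u < m ] 𝟙 (P u Fin.≟ j)) ≡ ∑[ u < m ] c (P u)
∑-fibres {m} {k} P c = begin
  ∑[ j < k ] (c j * ∑[ u < m ] 𝟙 (P u Fin.≟ j)) ≡⟨ sum-cong-≗ (λ j → *-distribˡ-sum (c j) (λ u → 𝟙 (P u Fin.≟ j))) ⟩
  ∑[ j < k ] ∑[ u < m ] (c j * 𝟙 (P u Fin.≟ j)) ≡⟨ ∑-comm (λ j u → c j * 𝟙 (P u Fin.≟ j)) ⟩
  ∑[ u < m ] ∑[ j < k ] (c j * 𝟙 (P u Fin.≟ j)) ≡⟨ sum-cong-≗ (λ u → ∑-delta c (P u)) ⟩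
  ∑[ u < m ] c (P u)                             ∎
  where open ≡-Reasoning

∑-allFin : ∀ k (h : Fin k → ℕ) → List.sum (map h (allFin k)) ≡ ∑[ i < k ] h i
∑-allFin k h = ∑-tabulate k (λ i → i)
  where
  ∑-tabulate : ∀ k {A : Set} (t : Fin k → A) {h : A → ℕ} → List.sum (map h (tabulate t)) ≡ ∑[ i < k ] h (t i)
  ∑-tabulate zero t = refl
  ∑-tabulate (suc k) t {h} = cong (h (t zero) +_) (∑-tabulate k (t ∘ suc))

∑-lookup : ∀ {A : Set} (xs : List A) (φ : A → ℕ) → ∑[ x < length xs ] φ (lookup xs x) ≡ List.sum (map φ xs)
∑-lookup [] φ = refl
∑-lookup (x ∷ xs) φ = cong (φ x +_) (∑-lookup xs φ)

∑-filter : ∀ {A : Set} {P : Pred A _} (P? : Decidable P) (xs : List A) (φ : A → ℕ) →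
  List.sum (map φ (filter P? xs)) ≡ List.sum (map (λ u → 𝟙 (P? u) * φ u) xs)
∑-filter P? [] φ = refl
∑-filter P? (x ∷ xs) φ with does (P? x)
... | true = cong₂ _+_ (sym (+-identityʳ (φ x))) (∑-filter P? xs φ)
... | false = ∑-filter P? xs φ

length-filter : ∀ {A : Set} {P : Pred A _} (P? : Decidable P) (xs : List A) →
  length (filter P? xs) ≡ List.sum (map (𝟙 ∘ P?) xs)
length-filter P? [] = refl
length-filter P? (x ∷ xs) with does (P? x)
... | true = cong suc (length-filter P? xs)
... | false = length-filter P? xs

lookup-injective : ∀ {A : Set} (xs : List A) → Unique xs → ∀ x y → lookup xs x ≡ lookup xs y → x ≡ y
lookup-injective (a ∷ xs) u zero zero e = refl
lookup-injective (a ∷ xs) (a∉ ∷ u) zero (suc y) e = ⊥-elim (All.lookup a∉ (∈-lookup y) e)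
lookup-injective (a ∷ xs) (a∉ ∷ u) (suc x) zero e = ⊥-elim (All.lookup a∉ (∈-lookup x) (sym e))
lookup-injective (a ∷ xs) (a∉ ∷ u) (suc x) (suc y) e = cong suc (lookup-injective xs u x y e)

-- All pairs {a, b}, a ≠ b, between the classes i and j of Π have adjacency c;
-- Homogeneous F Π i j is Uniform F Π i j true ⊎ Uniform F Π i j false.
Uniform : (F : Graph) {m : ℕ} → Partition F m → Fin m → Fin m → Bool → Set
Uniform F Π i j c = ∀ a b → Π a ≡ i → Π b ≡ j → ¬ (a ≡ b) → adj F a b ≡ c

badPair : (G : Graph) {k : ℕ} → Partition G k → Fin k → Fin k → ℕ
badPair G P i j = 𝟙 (¬? (homogeneous? G P i j))

-- The bad mass counts the ordered pairs of vertices (u, v) whose parts do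
-- not form a homogeneous pair: group the vertex pairs by their parts.
badMass-pairs : (G : Graph) {k : ℕ} (P : Partition G k) →
  badMass G P ≡ ∑[ u < n G ] ∑[ v < n G ] badPair G P (P u) (P v)
badMass-pairs G {k} P = begin
  badMass G P                                       ≡⟨ ∑-allFin k _ ⟩
  ∑[ i < k ] List.sum (map (term i) (allFin k))     ≡⟨ sum-cong-≗ (λ i → ∑-allFin k (term i)) ⟩
  ∑[ i < k ] ∑[ j < k ] term i j                    ≡⟨ sum-cong-≗ (λ i → sum-cong-≗ (term-split i)) ⟩
  ∑[ i < k ] ∑[ j < k ] (badPair G P i j * size i * size j)
    ≡⟨ sum-cong-≗ (λ i → ∑-fibres P (λ j → badPair G P i j * size i)) ⟩
  ∑[ i < k ] ∑[ v < n G ] (badPair G P i (P v) * size i)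
    ≡⟨ sum-cong-≗ (λ i → sym (*-distribʳ-sum (size i) (λ v → badPair G P i (P v)))) ⟩
  ∑[ i < k ] (∑[ v < n G ] badPair G P i (P v) * size i)
    ≡⟨ ∑-fibres P (λ i → ∑[ v < n G ] badPair G P i (P v)) ⟩
  ∑[ u < n G ] ∑[ v < n G ] badPair G P (P u) (P v) ∎
  where
  open ≡-Reasoning
  size : Fin k → ℕ
  size j = ∑[ u < n G ] 𝟙 (P u Fin.≟ j)
  term : Fin k → Fin k → ℕ
  term i j = if does (homogeneous? G P i j) then 0 else partSize G P i * partSize G P j
  partSize-count : ∀ j → partSize G P j ≡ size j
  partSize-count j = trans (length-filter (λ v → P v Fin.≟ j) (allFin (n G))) (∑-allFin (n G) _)
  term-split : ∀ i j → term i j ≡ badPair G P i j * size i * size j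
  term-split i j with does (homogeneous? G P i j)
  ... | true = refl
  ... | false = cong₂ _*_ (trans (partSize-count i) (sym (+-identityʳ (size i)))) (partSize-count j)

-- A bound holding strictly on nonempty graphs holds weakly on all graphs,
-- the empty graph having bad mass 0.
strict-if-nonempty⇒≤ : ∀ (H : Graph) {k} (R : Partition H k) c M →
  (0 < n H → c * badMass H R < M) → c * badMass H R ≤ M
strict-if-nonempty⇒≤ H@record { n = zero } R c M _ =
  subst (λ b → c * b ≤ M) (sym (badMass-pairs H R)) (≤-trans (≤-reflexive (*-zeroʳ c)) z≤n)
strict-if-nonempty⇒≤ H@record { n = suc _ } R c M bound = <⇒≤ (bound (s≤s z≤n))

restrict : ∀ {m} → (Fin m → Bool) → (Fin m → Fin m → ℕ) → Fin m → Fin m → ℕ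
restrict S g u v = 𝟙ᵇ (S u) * (𝟙ᵇ (S v) * g u v)

-- The induced subgraph G[S] has as vertices the positions in the list
-- `members` of the vertices in S; `embed` maps them back into G and
-- `position` is its inverse on S (its membership argument is irrelevant).
module Induced (G : Graph) (S : Fin (n G) → Bool) where

  members : List (Fin (n G))
  members = filter (λ v → T? (S v)) (allFin (n G))

  H : Graph
  H = induced G S

  embed : Fin (n H) → Fin (n G)
  embed = lookup members

  embed-∈ : ∀ x → T (S (embed x))
  embed-∈ x = proj₂ (∈-filter⁻ (λ v → T? (S v)) {xs = allFin (n G)} (∈-lookup {xs = members} x))

  member : ∀ u → T (S u) → u ∈ members
  member u m = ∈-filter⁺ (λ v → T? (S v)) (∈-allFin u) m

  position : ∀ u → .(T (S u)) → Fin (n H)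
  position u m = Any.index (member u (recompute (T? (S u)) m))

  embed-position : ∀ u .(m : T (S u)) → embed (position u m) ≡ u
  embed-position u m = sym (lookup-index (member u (recompute (T? (S u)) m)))

  position-embed : ∀ x .(m : T (S (embed x))) → position (embed x) m ≡ x
  position-embed x m = lookup-injective members (filter⁺ (λ v → T? (S v)) (allFin⁺ (n G))) _ _
    (embed-position (embed x) m)

  ∑-embed : ∀ (φ : Fin (n G) → ℕ) → ∑[ x < n H ] φ (embed x) ≡ ∑[ u < n G ] (𝟙ᵇ (S u) * φ u)
  ∑-embed φ = trans (∑-lookup members φ)
    (trans (∑-filter (λ v → T? (S v)) (allFin (n G)) φ) (∑-allFin (n G) (λ u → 𝟙ᵇ (S u) * φ u)))

  ∑∑-embed : ∀ (g : Fin (n G) → Fin (n G) → ℕ) →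
    ∑[ x < n H ] ∑[ y < n H ] g (embed x) (embed y) ≡ ∑[ u < n G ] ∑[ v < n G ] restrict S g u v
  ∑∑-embed g = trans (∑-embed (λ u → ∑[ y < n H ] g u (embed y)))
    (sum-cong-≗ (λ u → trans (cong (𝟙ᵇ (S u) *_) (∑-embed (g u)))
                             (*-distribˡ-sum (𝟙ᵇ (S u)) (λ v → 𝟙ᵇ (S v) * g u v))))

  -- Let P be a partition of G whose classes meeting S lie inside S and which
  -- refines the partition R of G[S] on S.  Then homogeneous pairs of R-classes
  -- come from homogeneous pairs of P-classes, so the bad mass of P inside S
  -- is at most the bad mass of R.
  module Refining {k l : ℕ} (P : Partition G k) (R : Partition H l)
    (closed : ∀ a x → P a ≡ P (embed x) → T (S a))
    (refines : ∀ x y → P (embed x) ≡ P (embed y) → R x ≡ R y) where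

    uniform-lift : ∀ x y c → Uniform H R (R x) (R y) c → Uniform G P (P (embed x)) (P (embed y)) c
    uniform-lift x y c h a b ea eb a≢b =
      subst₂ (λ a b → adj G a b ≡ c) (embed-position a ma) (embed-position b mb)
        (h (position a ma) (position b mb) (via a x ma ea) (via b y mb eb)
           (λ e → a≢b (trans (sym (embed-position a ma)) (trans (cong embed e) (embed-position b mb)))))
      where
      ma = closed a x ea
      mb = closed b y eb
      via : ∀ a x .(ma : T (S a)) → P a ≡ P (embed x) → R (position a ma) ≡ R x
      via a x ma e = refines _ x (trans (cong P (embed-position a ma)) e)

    badPair-lift : ∀ x y → badPair G P (P (embed x)) (P (embed y)) ≤ badPair H R (R x) (R y)
    badPair-lift x y = 𝟙¬-mono (homogeneous? G P _ _) (homogeneous? H R _ _)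
      (Sum.map (uniform-lift x y true) (uniform-lift x y false))

    badMass-restrict : ∑[ u < n G ] ∑[ v < n G ] restrict S (λ u v → badPair G P (P u) (P v)) u v ≤ badMass H R
    badMass-restrict = subst₂ _≤_ (∑∑-embed (λ u v → badPair G P (P u) (P v))) (sym (badMass-pairs H R))
      (∑-mono-≤ (λ x → ∑-mono-≤ (badPair-lift x)))

onlyIf : ∀ {A : Set} → Dec A → (A → ℕ) → ℕ
onlyIf (yes a) g = g a
onlyIf (no _) g = 0

onlyIf-mono : ∀ {A : Set} (d : Dec A) {g h : A → ℕ} → (∀ a → g a ≤ h a) → onlyIf d g ≤ onlyIf d h
onlyIf-mono (yes a) g≤h = g≤h a
onlyIf-mono (no _) g≤h = z≤n

onlyIf-*ˡ : ∀ {A : Set} (d : Dec A) (c : ℕ) (g : A → ℕ) → c * onlyIf d g ≡ onlyIf d (λ a → c * g a)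
onlyIf-*ˡ (yes a) c g = refl
onlyIf-*ˡ (no _) c g = *-zeroʳ c

onlyIf-∑ : ∀ {A : Set} {m} (d : Dec A) (g : A → Fin m → ℕ) →
  ∑[ u < m ] onlyIf d (λ a → g a u) ≡ onlyIf d (λ a → ∑[ u < m ] g a u)
onlyIf-∑ (yes a) g = refl
onlyIf-∑ {m = m} (no _) g = trans (∑-const m 0) (*-zeroʳ m)

onlyIf-const : ∀ {A : Set} (d : Dec A) (x : ℕ) → onlyIf d (λ _ → x) ≡ 𝟙 d * x
onlyIf-const (yes _) x = sym (+-identityʳ x)
onlyIf-const (no _) x = refl

∑< : ∀ k → ((i j : Fin k) → .(i Fin.< j) → ℕ) → ℕ
∑< k F = ∑[ i < k ] ∑[ j < k ] onlyIf (i Fin.<? j) (λ lt → F i j lt)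

∑<-mono-≤ : ∀ {k} {F F′ : (i j : Fin k) → .(i Fin.< j) → ℕ} →
  (∀ i j .lt → F i j lt ≤ F′ i j lt) → ∑< k F ≤ ∑< k F′
∑<-mono-≤ F≤F′ = ∑-mono-≤ (λ i → ∑-mono-≤ (λ j → onlyIf-mono (i Fin.<? j) (λ lt → F≤F′ i j lt)))

∑<-term : ∀ {k} (F : (i j : Fin k) → .(i Fin.< j) → ℕ) i j → (lt : i Fin.< j) → F i j lt ≤ ∑< k F
∑<-term {k} F i j lt = ≤-trans (≤-trans (onlyIf-yes (i Fin.<? j)) (term≤∑ _ j)) (term≤∑ _ i)
  where
  onlyIf-yes : (d : Dec (i Fin.< j)) → F i j lt ≤ onlyIf d (λ lt → F i j lt)
  onlyIf-yes (yes _) = ≤-refl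
  onlyIf-yes (no ¬lt) = ⊥-elim (¬lt lt)

∑<-mono-< : ∀ {k} {F F′ : (i j : Fin k) → .(i Fin.< j) → ℕ} →
  (∀ i j .lt → F i j lt ≤ F′ i j lt) → ∀ i j → (lt : i Fin.< j) → F i j lt < F′ i j lt → ∑< k F < ∑< k F′
∑<-mono-< {F = F} {F′} F≤F′ i j lt F<F′ =
  ∑-mono-< (λ a → ∑-mono-≤ (λ b → onlyIf-mono (a Fin.<? b) (λ lt → F≤F′ a b lt))) i
    (∑-mono-< (λ b → onlyIf-mono (i Fin.<? b) (λ lt → F≤F′ i b lt)) j (onlyIf-yes (i Fin.<? j)))
  where
  onlyIf-yes : (d : Dec (i Fin.< j)) → onlyIf d (λ lt → F i j lt) < onlyIf d (λ lt → F′ i j lt)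
  onlyIf-yes (yes _) = F<F′
  onlyIf-yes (no ¬lt) = ⊥-elim (¬lt lt)

∑<-*ˡ : ∀ {k} (c : ℕ) (F : (i j : Fin k) → .(i Fin.< j) → ℕ) → c * ∑< k F ≡ ∑< k (λ i j lt → c * F i j lt)
∑<-*ˡ {k} c F = trans (*-distribˡ-sum c (λ i → ∑[ j < k ] row i j)) (sum-cong-≗ (λ i →
  trans (*-distribˡ-sum c (row i)) (sum-cong-≗ (λ j → onlyIf-*ˡ (i Fin.<? j) c (λ lt → F i j lt)))))
  where
  row : Fin k → Fin k → ℕ
  row i j = onlyIf (i Fin.<? j) (λ lt → F i j lt)

∑<-∑∑ : ∀ {k m} (g : Fin k → Fin k → Fin m → Fin m → ℕ) →
  ∑[ u < m ] ∑[ v < m ] ∑< k (λ i j _ → g i j u v) ≡ ∑< k (λ i j _ → ∑[ u < m ] ∑[ v < m ] g i j u v)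
∑<-∑∑ {k} {m} g = begin
  ∑[ u < m ] ∑[ v < m ] ∑[ i < k ] ∑[ j < k ] h i j u v   ≡⟨ sum-cong-≗ (λ u → ∑-comm (λ v i → ∑[ j < k ] h i j u v)) ⟩
  ∑[ u < m ] ∑[ i < k ] ∑[ v < m ] ∑[ j < k ] h i j u v   ≡⟨ ∑-comm (λ u i → ∑[ v < m ] ∑[ j < k ] h i j u v) ⟩
  ∑[ i < k ] ∑[ u < m ] ∑[ v < m ] ∑[ j < k ] h i j u v   ≡⟨ sum-cong-≗ (λ i → sum-cong-≗ (λ u → ∑-comm (λ v j → h i j u v))) ⟩
  ∑[ i < k ] ∑[ u < m ] ∑[ j < k ] ∑[ v < m ] h i j u v   ≡⟨ sum-cong-≗ (λ i → ∑-comm (λ u j → ∑[ v < m ] h i j u v)) ⟩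
  ∑[ i < k ] ∑[ j < k ] ∑[ u < m ] ∑[ v < m ] h i j u v   ≡⟨ sum-cong-≗ (λ i → sum-cong-≗ (λ j → onlyIf-∑∑ i j)) ⟩
  ∑< k (λ i j _ → ∑[ u < m ] ∑[ v < m ] g i j u v)       ∎
  where
  open ≡-Reasoning
  h : Fin k → Fin k → Fin m → Fin m → ℕ
  h i j u v = onlyIf (i Fin.<? j) (λ _ → g i j u v)
  onlyIf-∑∑ : ∀ i j → ∑[ u < m ] ∑[ v < m ] h i j u v ≡ onlyIf (i Fin.<? j) (λ _ → ∑[ u < m ] ∑[ v < m ] g i j u v)
  onlyIf-∑∑ i j = trans (sum-cong-≗ (λ u → onlyIf-∑ (i Fin.<? j) (λ _ v → g i j u v)))
                        (onlyIf-∑ (i Fin.<? j) (λ _ u → ∑[ v < m ] g i j u v))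

𝟙-trichotomy : ∀ {k} (a j : Fin k) → 𝟙 (a Fin.<? j) + 𝟙 (j Fin.<? a) + 𝟙 (a Fin.≟ j) ≡ 1
𝟙-trichotomy a j with Fin.<-cmp a j
... | tri< a<j a≢j a≯j = cong₂ _+_ (cong₂ _+_ (𝟙-yes (a Fin.<? j) a<j) (𝟙-no (j Fin.<? a) a≯j)) (𝟙-no (a Fin.≟ j) a≢j)
... | tri≈ a≮j a≡j a≯j = cong₂ _+_ (cong₂ _+_ (𝟙-no (a Fin.<? j) a≮j) (𝟙-no (j Fin.<? a) a≯j)) (𝟙-yes (a Fin.≟ j) a≡j)
... | tri> a≮j a≢j a>j = cong₂ _+_ (cong₂ _+_ (𝟙-no (a Fin.<? j) a≮j) (𝟙-yes (j Fin.<? a) a>j)) (𝟙-no (a Fin.≟ j) a≢j)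

smaller+larger : ∀ k (a : Fin (suc k)) → ∑[ j < suc k ] 𝟙 (a Fin.<? j) + ∑[ j < suc k ] 𝟙 (j Fin.<? a) ≡ k
smaller+larger k a = +-cancelʳ-≡ 1 _ _ (begin
  ∑[ j < p ] 𝟙 (a Fin.<? j) + ∑[ j < p ] 𝟙 (j Fin.<? a) + 1
    ≡⟨ cong₂ _+_ (sym (∑-distrib-+ (λ (j : Fin p) → 𝟙 (a Fin.<? j)) (λ (j : Fin p) → 𝟙 (j Fin.<? a)))) (sym equal) ⟩
  ∑[ j < p ] (𝟙 (a Fin.<? j) + 𝟙 (j Fin.<? a)) + ∑[ j < p ] 𝟙 (a Fin.≟ j)
    ≡⟨ sym (∑-distrib-+ (λ j → 𝟙 (a Fin.<? j) + 𝟙 (j Fin.<? a)) (λ j → 𝟙 (a Fin.≟ j))) ⟩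
  ∑[ j < p ] (𝟙 (a Fin.<? j) + 𝟙 (j Fin.<? a) + 𝟙 (a Fin.≟ j))
    ≡⟨ sum-cong-≗ (𝟙-trichotomy a) ⟩
  ∑[ j < p ] 1
    ≡⟨ trans (∑-const p 1) (trans (*-identityʳ p) (+-comm 1 k)) ⟩
  k + 1 ∎)
  where
  open ≡-Reasoning
  p = suc k
  equal : ∑[ j < p ] 𝟙 (a Fin.≟ j) ≡ 1
  equal = trans (sum-cong-≗ (λ j → sym (*-identityˡ (𝟙 (a Fin.≟ j))))) (∑-delta (λ _ → 1) a)

-- An element a of Fin (1 + k) lies in exactly k of the pairs i < j: those
-- where a is the smaller element and those where it is the larger one.
pairs-containing : ∀ k (a : Fin (suc k)) → ∑< (suc k) (λ i j _ → 𝟙 (a Fin.≟ i) + 𝟙 (a Fin.≟ j)) ≡ k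
pairs-containing k a = begin
  ∑< p (λ i j _ → 𝟙 (a Fin.≟ i) + 𝟙 (a Fin.≟ j))
    ≡⟨ sum-cong-≗ (λ i → sum-cong-≗ (λ j → trans (onlyIf-const (i Fin.<? j) (𝟙 (a Fin.≟ i) + 𝟙 (a Fin.≟ j)))
                                                   (*-distribˡ-+ (𝟙 (i Fin.<? j)) (𝟙 (a Fin.≟ i)) (𝟙 (a Fin.≟ j))))) ⟩
  ∑[ i < p ] ∑[ j < p ] (lt i j * 𝟙 (a Fin.≟ i) + lt i j * 𝟙 (a Fin.≟ j))
    ≡⟨ sum-cong-≗ (λ i → ∑-distrib-+ (λ j → lt i j * 𝟙 (a Fin.≟ i)) (λ j → lt i j * 𝟙 (a Fin.≟ j))) ⟩
  ∑[ i < p ] (∑[ j < p ] (lt i j * 𝟙 (a Fin.≟ i)) + ∑[ j < p ] (lt i j * 𝟙 (a Fin.≟ j)))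
    ≡⟨ ∑-distrib-+ (λ i → ∑[ j < p ] (lt i j * 𝟙 (a Fin.≟ i))) (λ i → ∑[ j < p ] (lt i j * 𝟙 (a Fin.≟ j))) ⟩
  ∑[ i < p ] ∑[ j < p ] (lt i j * 𝟙 (a Fin.≟ i)) + ∑[ i < p ] ∑[ j < p ] (lt i j * 𝟙 (a Fin.≟ j))
    ≡⟨ cong₂ _+_ as-smaller as-larger ⟩
  ∑[ j < p ] 𝟙 (a Fin.<? j) + ∑[ j < p ] 𝟙 (j Fin.<? a)
    ≡⟨ smaller+larger k a ⟩
  k ∎
  where
  open ≡-Reasoning
  p = suc k
  lt : Fin p → Fin p → ℕ
  lt i j = 𝟙 (i Fin.<? j)
  as-smaller : ∑[ i < p ] ∑[ j < p ] (lt i j * 𝟙 (a Fin.≟ i)) ≡ ∑[ j < p ] 𝟙 (a Fin.<? j)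
  as-smaller = trans (sum-cong-≗ (λ i → sym (*-distribʳ-sum (𝟙 (a Fin.≟ i)) (lt i))))
                     (∑-delta (λ i → ∑[ j < p ] lt i j) a)
  as-larger : ∑[ i < p ] ∑[ j < p ] (lt i j * 𝟙 (a Fin.≟ j)) ≡ ∑[ i < p ] 𝟙 (i Fin.<? a)
  as-larger = trans (∑-comm (λ i j → lt i j * 𝟙 (a Fin.≟ j)))
              (trans (sum-cong-≗ (λ j → sym (*-distribʳ-sum (𝟙 (a Fin.≟ j)) (λ i → lt i j))))
                     (∑-delta (λ j → ∑[ i < p ] lt i j) a))

-- A vertex u is labelled by its part Q u together with its R-class in the
-- q graphs G[V_{Q u} ∪ V_b], b ≠ Q u.
module CommonRefinement (G : Graph) {q f : ℕ} (Q : Partition G (suc q))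
  (R : (i j : Fin (suc q)) → .(i Fin.< j) → Partition (induced G (unionPart {G} Q i j)) f) where

  p : ℕ
  p = suc q

  S : Fin p → Fin p → Fin (n G) → Bool
  S i j = unionPart {G} Q i j

  module I (i j : Fin p) = Induced G (S i j)

  ∈-pair : ∀ {i j u} → Q u ≡ i ⊎ Q u ≡ j → T (S i j u)
  ∈-pair {i} {j} {u} = Equivalence.from (T-∨ {isYes (Q u Fin.≟ i)}) ∘ Sum.map fromWitness fromWitness

  ∈-pair⁻ : ∀ {i j u} → T (S i j u) → Q u ≡ i ⊎ Q u ≡ j
  ∈-pair⁻ {i} {j} {u} = Sum.map toWitness toWitness ∘ Equivalence.to (T-∨ {isYes (Q u Fin.≟ i)})

  label : (u : Fin (n G)) (b : Fin p) → .(Q u ≢ b) → Fin f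
  label u b Qu≢b with Fin.<-cmp (Q u) b
  ... | tri< Qu<b _ _ = R (Q u) b Qu<b (I.position (Q u) b u (∈-pair (inj₁ refl)))
  ... | tri≈ _ Qu≡b _ = Irrelevant.⊥-elim (Qu≢b Qu≡b)
  ... | tri> _ _ b<Qu = R b (Q u) b<Qu (I.position b (Q u) u (∈-pair (inj₂ refl)))

  label-cong : ∀ u {b b′} .(Qu≢b : Q u ≢ b) .(Qu≢b′ : Q u ≢ b′) → b ≡ b′ → label u b Qu≢b ≡ label u b′ Qu≢b′
  label-cong u _ _ refl = refl

  Opposite : (i j : Fin p) → Fin (n G) → Fin p → Set
  Opposite i j u b = (Q u ≡ i × b ≡ j) ⊎ (Q u ≡ j × b ≡ i)

  opposite : ∀ i j u → T (S i j u) → Σ (Fin p) (Opposite i j u)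
  opposite i j u m = Sum.[ (λ e → j , inj₁ (e , refl)) , (λ e → i , inj₂ (e , refl)) ] (∈-pair⁻ m)

  opposite-≢ : ∀ {i j u b} → i Fin.< j → Opposite i j u b → Q u ≢ b
  opposite-≢ i<j (inj₁ (Qu≡i , b≡j)) Qu≡b = Fin.<-irrefl (trans (sym Qu≡i) (trans Qu≡b b≡j)) i<j
  opposite-≢ i<j (inj₂ (Qu≡j , b≡i)) Qu≡b = Fin.<-irrefl (trans (sym b≡i) (trans (sym Qu≡b) Qu≡j)) i<j

  opposite-transport : ∀ {i j u v b} → Q u ≡ Q v → Opposite i j u b → Opposite i j v b
  opposite-transport Qu≡Qv (inj₁ (Qu≡i , b≡j)) = inj₁ (trans (sym Qu≡Qv) Qu≡i , b≡j)
  opposite-transport Qu≡Qv (inj₂ (Qu≡j , b≡i)) = inj₂ (trans (sym Qu≡Qv) Qu≡j , b≡i)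

  label-opposite : ∀ u b .(Qu≢b : Q u ≢ b) i j .(i<j : i Fin.< j) .(m : T (S i j u)) →
    Opposite i j u b → label u b Qu≢b ≡ R i j i<j (I.position i j u m)
  label-opposite u b Qu≢b .(Q u) .b i<j m (inj₁ (refl , refl)) with Fin.<-cmp (Q u) b
  ... | tri< _ _ _ = refl
  ... | tri≈ _ Qu≡b _ = Irrelevant.⊥-elim (Qu≢b Qu≡b)
  ... | tri> _ _ b<Qu = Irrelevant.⊥-elim (Fin.<-asym i<j b<Qu)
  label-opposite u b Qu≢b .b .(Q u) i<j m (inj₂ (refl , refl)) with Fin.<-cmp (Q u) b
  ... | tri< Qu<b _ _ = Irrelevant.⊥-elim (Fin.<-asym i<j Qu<b)
  ... | tri≈ _ Qu≡b _ = Irrelevant.⊥-elim (Qu≢b Qu≡b)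
  ... | tri> _ _ _ = refl

  -- the labels of u towards the q parts other than Q u, indexed via punchIn
  labels : Fin (n G) → Fin q → Fin f
  labels u t = label u (Fin.punchIn (Q u) t) (Fin.punchInᵢ≢i (Q u) t ∘ sym)

  refinement : Partition G (p * f ^ q)
  refinement u = Fin.combine (Q u) (Fin.funToFin (labels u))

  same-part : ∀ {u v} → refinement u ≡ refinement v → Q u ≡ Q v
  same-part {u} {v} e = Fin.combine-injectiveˡ (Q u) _ (Q v) _ e

  same-label : ∀ {u v} → refinement u ≡ refinement v → ∀ b (Qu≢b : Q u ≢ b) .(Qv≢b : Q v ≢ b) →
    label u b Qu≢b ≡ label v b Qv≢b
  same-label {u} {v} e b Qu≢b Qv≢b = begin
    label u b Qu≢b                      ≡⟨ label-cong u Qu≢b _ (sym (Fin.punchIn-punchOut Qu≢b)) ⟩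
    labels u t                          ≡⟨ sym (Fin.finToFun-funToFin (labels u) t) ⟩
    Fin.finToFun (Fin.funToFin (labels u)) t ≡⟨ cong (λ c → Fin.finToFun c t) (Fin.combine-injectiveʳ (Q u) _ (Q v) _ e) ⟩
    Fin.finToFun (Fin.funToFin (labels v)) t ≡⟨ Fin.finToFun-funToFin (labels v) t ⟩
    labels v t                          ≡⟨ label-cong v _ Qv≢b (trans (cong (λ a → Fin.punchIn a t) (sym (same-part e))) (Fin.punchIn-punchOut Qu≢b)) ⟩
    label v b Qv≢b                      ∎
    where
    open ≡-Reasoning
    t = Fin.punchOut Qu≢b

  H : Fin p → Fin p → Graph
  H i j = I.H i j

  -- The refinement refines each R_ij on V_i ∪ V_j: equal refinement classes
  -- mean equal labels towards the opposite endpoint, hence equal R_ij-classes.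
  refines : ∀ i j .(i<j : i Fin.< j) x y →
    refinement (I.embed i j x) ≡ refinement (I.embed i j y) → R i j i<j x ≡ R i j i<j y
  refines i j i<j x y e = begin
    R i j i<j x                             ≡⟨ cong (R i j i<j) (sym (I.position-embed i j x mx)) ⟩
    R i j i<j (I.position i j u mx)         ≡⟨ sym (label-opposite u b (opposite-≢ lt opp-u) i j i<j mx opp-u) ⟩
    label u b (opposite-≢ lt opp-u)         ≡⟨ same-label e b (opposite-≢ lt opp-u) (opposite-≢ lt opp-v) ⟩
    label v b (opposite-≢ lt opp-v)         ≡⟨ label-opposite v b (opposite-≢ lt opp-v) i j i<j my opp-v ⟩
    R i j i<j (I.position i j v my)         ≡⟨ cong (R i j i<j) (I.position-embed i j y my) ⟩
    R i j i<j y                             ∎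
    where
    open ≡-Reasoning
    lt : i Fin.< j
    lt = recompute (i Fin.<? j) i<j
    u = I.embed i j x
    v = I.embed i j y
    mx = I.embed-∈ i j x
    my = I.embed-∈ i j y
    b = proj₁ (opposite i j u mx)
    opp-u = proj₂ (opposite i j u mx)
    opp-v : Opposite i j v b
    opp-v = opposite-transport (same-part e) opp-u

  closed : ∀ i j a x → refinement a ≡ refinement (I.embed i j x) → T (S i j a)
  closed i j a x e = ∈-pair (Sum.map (trans (same-part e)) (trans (same-part e)) (∈-pair⁻ (I.embed-∈ i j x)))

  covering-pair : ∀ a b → a ≢ b → ∀ {u v} → Q u ≡ a ⊎ Q u ≡ b → Q v ≡ a ⊎ Q v ≡ b →
    Σ (Fin p) λ i → Σ (Fin p) λ j → i Fin.< j × T (S i j u) × T (S i j v)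
  covering-pair a b a≢b Qu∈ Qv∈ with Fin.<-cmp a b
  ... | tri< a<b _ _ = a , b , a<b , ∈-pair Qu∈ , ∈-pair Qv∈
  ... | tri≈ _ a≡b _ = ⊥-elim (a≢b a≡b)
  ... | tri> _ _ b<a = b , a , b<a , ∈-pair (Sum.swap Qu∈) , ∈-pair (Sum.swap Qv∈)

  cover : 0 < q → ∀ u v → Σ (Fin p) λ i → Σ (Fin p) λ j → i Fin.< j × T (S i j u) × T (S i j v)
  cover q>0 u v with Q u Fin.≟ Q v
  ... | yes Qu≡Qv = covering-pair (Q u) other (Fin.punchInᵢ≢i (Q u) t ∘ sym) (inj₁ refl) (inj₁ (sym Qu≡Qv))
    where
    t = Fin.fromℕ< q>0
    other = Fin.punchIn (Q u) t
  ... | no Qu≢Qv = covering-pair (Q u) (Q v) Qu≢Qv (inj₁ refl) (inj₂ refl)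

  -- Every bad pair of vertices of the refinement is bad for some R_ij, so
  -- its bad mass is at most the total bad mass of the R_ij.
  badMass-refinement : 0 < q → badMass G refinement ≤ ∑< p (λ i j i<j → badMass (H i j) (R i j i<j))
  badMass-refinement q>0 = begin
    badMass G refinement
      ≡⟨ badMass-pairs G refinement ⟩
    ∑[ u < n G ] ∑[ v < n G ] bad u v
      ≤⟨ ∑-mono-≤ (λ u → ∑-mono-≤ (λ v → covered u v)) ⟩
    ∑[ u < n G ] ∑[ v < n G ] ∑< p (λ i j _ → restrict (S i j) bad u v)
      ≡⟨ ∑<-∑∑ (λ i j → restrict (S i j) bad) ⟩
    ∑< p (λ i j _ → ∑[ u < n G ] ∑[ v < n G ] restrict (S i j) bad u v)
      ≤⟨ ∑<-mono-≤ (λ i j i<j → I.Refining.badMass-restrict i j refinement (R i j i<j) (closed i j) (refines i j i<j)) ⟩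
    ∑< p (λ i j i<j → badMass (H i j) (R i j i<j)) ∎
    where
    open ≤-Reasoning
    bad : Fin (n G) → Fin (n G) → ℕ
    bad u v = badPair G refinement (refinement u) (refinement v)
    covered : ∀ u v → bad u v ≤ ∑< p (λ i j _ → restrict (S i j) bad u v)
    covered u v with cover q>0 u v
    ... | i , j , i<j , mu , mv = subst (_≤ ∑< p (λ i j _ → restrict (S i j) bad u v))
            (trans (cong₂ (λ x y → x * (y * bad u v)) (𝟙ᵇ-T mu) (𝟙ᵇ-T mv)) (trans (*-identityˡ _) (*-identityˡ _)))
            (∑<-term (λ i j _ → restrict (S i j) bad u v) i j i<j)

  -- A vertex u lies in V_i ∪ V_j for exactly q pairs i < j, so
  -- Σ_{i<j} |V_i ∪ V_j|² ≤ q n².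
  ∑<-sizes : ∑< p (λ i j _ → n (H i j) * n (H i j)) ≤ q * (n G * n G)
  ∑<-sizes = begin
    ∑< p (λ i j _ → n (H i j) * n (H i j))
      ≤⟨ ∑<-mono-≤ (λ i j _ → ≤-reflexive (size² i j)) ⟩
    ∑< p (λ i j _ → ∑[ u < n G ] ∑[ v < n G ] restrict (S i j) one u v)
      ≡⟨ sym (∑<-∑∑ (λ i j → restrict (S i j) one)) ⟩
    ∑[ u < n G ] ∑[ v < n G ] ∑< p (λ i j _ → restrict (S i j) one u v)
      ≤⟨ ∑-mono-≤ (λ u → ∑-mono-≤ (λ v → pairs-through u v)) ⟩
    ∑[ u < n G ] ∑[ v < n G ] q
      ≡⟨ trans (∑-const (n G) (∑[ v < n G ] q)) (cong (n G *_) (∑-const (n G) q)) ⟩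
    n G * (n G * q)
      ≡⟨ trans (sym (*-assoc (n G) (n G) q)) (*-comm (n G * n G) q) ⟩
    q * (n G * n G) ∎
    where
    open ≤-Reasoning
    one : Fin (n G) → Fin (n G) → ℕ
    one _ _ = 1
    size² : ∀ i j → n (H i j) * n (H i j) ≡ ∑[ u < n G ] ∑[ v < n G ] restrict (S i j) one u v
    size² i j = trans (sym (trans (∑-const m (∑[ y < m ] 1)) (cong (m *_) (trans (∑-const m 1) (*-identityʳ m)))))
                      (I.∑∑-embed i j one)
      where m = n (H i j)
    pairs-through : ∀ u v → ∑< p (λ i j _ → restrict (S i j) one u v) ≤ q
    pairs-through u v = ≤-trans (∑<-mono-≤ (λ i j _ → ≤-trans (𝟙ᵇ-∧≤ (S i j u) (S i j v)) (in-pair i j)))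
                                (≤-reflexive (pairs-containing q (Q u)))
      where
      in-pair : ∀ i j → 𝟙ᵇ (S i j u) ≤ 𝟙 (Q u Fin.≟ i) + 𝟙 (Q u Fin.≟ j)
      in-pair i j = subst₂ (λ x y → 𝟙ᵇ (S i j u) ≤ x + y) (𝟙ᵇ-isYes (Q u Fin.≟ i)) (𝟙ᵇ-isYes (Q u Fin.≟ j))
                           (𝟙ᵇ-∨ (isYes (Q u Fin.≟ i)) (isYes (Q u Fin.≟ j)))

  nonempty-pair : 0 < q → 0 < n G → Σ (Fin p) λ i → Σ (Fin p) λ j → i Fin.< j × 0 < n (H i j)
  nonempty-pair q>0 n>0 with cover q>0 u₀ u₀
    where u₀ = Fin.fromℕ< n>0
  ... | i , j , i<j , m , _ = i , j , i<j , >-nonZero⁻¹ _ {{Fin.nonZeroIndex (I.position i j _ m)}}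

  badMass-refinement-bound : 0 < q → ∀ c N →
    (∀ i j .(i<j : i Fin.< j) → 0 < n (H i j) → c * badMass (H i j) (R i j i<j) < N * (n (H i j) * n (H i j))) →
    0 < n G → c * badMass G refinement < N * (q * (n G * n G))
  badMass-refinement-bound q>0 c N bound n>0 with nonempty-pair q>0 n>0
  ... | i₀ , j₀ , i₀<j₀ , H₀>0 = begin-strict
    c * badMass G refinement                  ≤⟨ *-monoʳ-≤ c (badMass-refinement q>0) ⟩
    c * ∑< p B                                ≡⟨ ∑<-*ˡ c B ⟩
    ∑< p (λ i j i<j → c * B i j i<j)          <⟨ ∑<-mono-< weak i₀ j₀ i₀<j₀ (bound i₀ j₀ i₀<j₀ H₀>0) ⟩
    ∑< p (λ i j _ → N * (n (H i j) * n (H i j))) ≡⟨ sym (∑<-*ˡ N (λ i j _ → n (H i j) * n (H i j))) ⟩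
    N * ∑< p (λ i j _ → n (H i j) * n (H i j))   ≤⟨ *-monoʳ-≤ N ∑<-sizes ⟩
    N * (q * (n G * n G))                     ∎
    where
    open ≤-Reasoning
    B : (i j : Fin p) → .(i Fin.< j) → ℕ
    B i j i<j = badMass (H i j) (R i j i<j)
    weak : ∀ i j .(i<j : i Fin.< j) → c * B i j i<j ≤ N * (n (H i j) * n (H i j))
    weak i j i<j = strict-if-nonempty⇒≤ (H i j) (R i j i<j) c _ (bound i j i<j)

-- A positive rational ε is N/d with N = ∣↥ε∣
-- and d = ↧ε; a comparison of s/(1+m) with ε, or with ε/(1+r), is then a
-- cross-multiplied inequality between natural numbers.
numerator-ℕ : ∀ (ε : ℚ) → 0ℚ ℚ.< ε → ℚ.↥ ε ≡ ℤ.+ ℤ.∣ ℚ.↥ ε ∣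
numerator-ℕ (mkℚ (ℤ.+ _) _ _) _ = refl
numerator-ℕ (mkℚ ℤ.-[1+ _ ] _ _) (ℚ.*<* ())

toℚᵘ-/ : ∀ s m → ℚ.toℚᵘ ((ℤ.+ s) ℚ./ suc m) ℚᵘ.≃ mkℚᵘ (ℤ.+ s) m
toℚᵘ-/ s m = ℚP.toℚᵘ-fromℚᵘ (mkℚᵘ (ℤ.+ s) m)

ℤ-cross⇒ : ∀ a b c e → ℤ.+ a ℤ.* ℤ.+ b ℤ.< ℤ.+ c ℤ.* ℤ.+ e → a * b < c * e
ℤ-cross⇒ a b c e h = ℤP.drop‿+<+ (subst₂ ℤ._<_ (sym (ℤP.pos-* a b)) (sym (ℤP.pos-* c e)) h)

⇒ℤ-cross : ∀ a b c e → a * b < c * e → ℤ.+ a ℤ.* ℤ.+ b ℤ.< ℤ.+ c ℤ.* ℤ.+ e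
⇒ℤ-cross a b c e h = subst₂ ℤ._<_ (ℤP.pos-* a b) (ℤP.pos-* c e) (ℤ.+<+ h)

frac<divBy : ∀ s m r (ε : ℚ) N → ℚ.↥ ε ≡ ℤ.+ N →
  (ℤ.+ s) ℚ./ suc m ℚ.< divBy ε (suc r) → (suc r * ℚ.↧ₙ ε) * s < N * suc m
frac<divBy s m r ε@(mkℚ _ d-1 _) N refl s/m<ε′ =
  subst (_< N * suc m) (trans (*-comm s (suc d-1 * suc r)) (cong (_* s) (*-comm (suc d-1) (suc r))))
    (ℤ-cross⇒ s (suc d-1 * suc r) N (suc m)
      (subst (λ z → ℤ.+ s ℤ.* ℤ.+ (suc d-1 * suc r) ℤ.< z ℤ.* ℤ.+ suc m) (ℤP.*-identityʳ (ℤ.+ N))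
        (ℚᵘP.drop-*<* unnormalised)))
  where
  ε′≃ : ℚ.toℚᵘ (divBy ε (suc r)) ℚᵘ.≃ mkℚᵘ (ℤ.+ N) d-1 ℚᵘ.* mkℚᵘ (ℤ.+ 1) r
  ε′≃ = ℚᵘP.≃-trans (ℚP.toℚᵘ-homo-* ε ((ℤ.+ 1) ℚ./ suc r)) (ℚᵘP.*-congˡ {mkℚᵘ (ℤ.+ N) d-1} (toℚᵘ-/ 1 r))
  unnormalised : mkℚᵘ (ℤ.+ s) m ℚᵘ.< mkℚᵘ (ℤ.+ N) d-1 ℚᵘ.* mkℚᵘ (ℤ.+ 1) r
  unnormalised = ℚᵘP.<-respʳ-≃ ε′≃ (ℚᵘP.<-respˡ-≃ (toℚᵘ-/ s m) (ℚP.toℚᵘ-mono-< s/m<ε′))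

<-frac : ∀ s m (ε : ℚ) N → ℚ.↥ ε ≡ ℤ.+ N → ℚ.↧ₙ ε * s < N * suc m → (ℤ.+ s) ℚ./ suc m ℚ.< ε
<-frac s m ε@(mkℚ _ d-1 _) N refl ds<Nm =
  ℚP.toℚᵘ-cancel-< (ℚᵘP.<-respˡ-≃ (ℚᵘP.≃-sym (toℚᵘ-/ s m))
    (*<* (⇒ℤ-cross s (suc d-1) N (suc m) (subst (_< N * suc m) (*-comm (suc d-1) s) ds<Nm))))

nice⇒bound : ∀ (H : Graph) {k} (R : Partition H k) r (ε : ℚ) N → ℚ.↥ ε ≡ ℤ.+ N →
  Nice H (divBy ε (suc r)) R → 0 < n H → (suc r * ℚ.↧ₙ ε) * badMass H R < N * (n H * n H)
nice⇒bound H@record { n = suc m } R r ε N ↥ε≡N nice _ = frac<divBy (badMass H R) (m + m * suc m) r ε N ↥ε≡N nice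

bound⇒nice : ∀ (G : Graph) {k} (P : Partition G k) (ε : ℚ) N → ℚ.↥ ε ≡ ℤ.+ N → 0ℚ ℚ.< ε →
  (0 < n G → ℚ.↧ₙ ε * badMass G P < N * (n G * n G)) → Nice G ε P
bound⇒nice record { n = zero } P ε N _ ε>0 _ = ε>0
bound⇒nice G@record { n = suc m } P ε N ↥ε≡N _ bound = <-frac (badMass G P) (m + m * suc m) ε N ↥ε≡N (bound (s≤s z≤n))

divBy-pos : ∀ (ε : ℚ) r → 0ℚ ℚ.< ε → 0ℚ ℚ.< divBy ε (suc r)
divBy-pos ε r ε>0 = ℚP.positive⁻¹ _
  {{ℚP.pos*pos⇒pos ε {{ℚ.positive ε>0}} ((ℤ.+ 1) ℚ./ suc r) {{ℚP.normalize-pos 1 (suc r)}}}}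

mainTheorem8 : (C D : Class) (f : ℚ → ℕ) (p : ℕ) →
    (∀ (ε : ℚ) → 0ℚ ℚ.< ε → ∀ (G : Graph) → D G →
      Σ (Partition G (f ε)) λ P → Nice G ε P) →
    TwoCoveredMagnitude C D p →
    ∀ (ε : ℚ) → 0ℚ ℚ.< ε → ∀ (G : Graph) → C G →
      Σ ℕ λ K → (K ≤ p * (f (divBy ε (p ∸ 1)) ^ (p ∸ 1))) × Σ (Partition G K) λ P → Nice G ε P
mainTheorem8 C D f (suc (suc r)) nice-in-D (s≤s (s≤s z≤n) , covered-by-D , _) ε ε>0 G G∈C =
  suc (suc r) * f ε′ ^ suc r , ≤-refl , refinement , bound⇒nice G refinement ε N ↥ε≡N ε>0 bound
  where
  ε′ = divBy ε (suc r)
  N = ℤ.∣ ℚ.↥ ε ∣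
  ↥ε≡N = numerator-ℕ ε ε>0
  Q = proj₁ (covered-by-D G G∈C)
  Pair : Fin (suc (suc r)) → Fin (suc (suc r)) → Graph
  Pair i j = induced G (unionPart {G} Q i j)
  nice-pair : ∀ i j .(i<j : i Fin.< j) → Σ (Partition (Pair i j) (f ε′)) (Nice (Pair i j) ε′)
  nice-pair i j i<j = nice-in-D ε′ (divBy-pos ε r ε>0) (Pair i j)
    (proj₂ (covered-by-D G G∈C) i j (recompute (i Fin.<? j) i<j))
  open CommonRefinement G Q (λ i j i<j → proj₁ (nice-pair i j i<j))
  -- (1+r)·d·bad(refinement) < N·(1+r)·n², then cancel 1 + r
  bound : 0 < n G → ℚ.↧ₙ ε * badMass G refinement < N * (n G * n G)
  bound n>0 = *-cancelˡ-< (suc r) _ _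
    (subst₂ _<_ (*-assoc (suc r) (ℚ.↧ₙ ε) _) (x∙yz≈y∙xz N (suc r) _)
      (badMass-refinement-bound (s≤s z≤n) (suc r * ℚ.↧ₙ ε) N
        (λ i j i<j → nice⇒bound (H i j) (proj₁ (nice-pair i j i<j)) r ε N ↥ε≡N (proj₂ (nice-pair i j i<j)))
        n>0))
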